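{- If $S$ is admissible and $2\in S$, then $\#P_B(S,n)=\#\widehat{P}_B(S,n)$.
   Context: $B_n$ is the set of signed permutations $\pi=\pi_1\cdots\pi_n$: words with each $\pi_i\in\{ -n,\dots,-1,1,\dots,n\}$ and $\{|\pi_1|,\dots,|\pi_n|\}=\{1,\dots,n\}$. Without padding, an index $i\in\{2,\dots,n-1\}$ is a peak of $\pi$ if $\pi_{i-1}<\pi_i>\pi_{i+1}$, and $P_B(S,n)$ is the set of $\pi\in B_n$ with this peak set equal to $S$. With $\pi_0=0$ prepended, an index $i\in\{1,\dots,n-1\}$ is a peak if $\pi_{i-1}<\pi_i>\pi_{i+1}$, and $\widehat{P}_B(S,n)$ is the set of $\pi\in B_n$ with this peak set equal to $S$. $S$ is $n$-admissible if $\#P_B(S,n)\ne0$; admissible means the identity is asserted for every $n$ for which $S$ is $n$-admissible. -}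

module Defs where

open import Data.Bool using (Bool; true; false; _∧_)
open import Data.Nat as ℕ using (ℕ; zero; suc; _∸_; _≡ᵇ_)
open import Data.Integer as ℤ using (ℤ; +_; -_; ∣_∣)
open import Data.List using (List; []; _∷_; _++_; map; concatMap; filterᵇ; length; applyUpTo)
open import Data.Bool.ListAction using (all; any)
open import Relation.Nullary.Decidable using (⌊_⌋)

-- [ lo .. hi ] as a list of naturals (empty if hi < lo)
interval : ℕ → ℕ → List ℕ
interval lo hi = applyUpTo (λ k → lo ℕ.+ k) (suc hi ∸ lo)

alphabet : ℕ → List ℤ
alphabet n = map +_ (interval 1 n) ++ map (λ k → - (+ k)) (interval 1 n)

words : List ℤ → ℕ → List (List ℤ)
words A zero    = [] ∷ []
words A (suc k) = concatMap (λ a → map (a ∷_) (words A k)) A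

-- {|π_1|,…,|π_n|} ⊇ {1,…,n}  (⊆ holds since letters come from the alphabet)
absCovers : ℕ → List ℤ → Bool
absCovers n π = all (λ k → any (λ x → ∣ x ∣ ≡ᵇ k) π) (interval 1 n)

-- B_n, the signed permutations of size n, as an explicit list of words π_1⋯π_n
B : ℕ → List (List ℤ)
B n = filterᵇ (absCovers n) (words (alphabet n) n)

-- 0-indexed lookup with default 0
get : List ℤ → ℕ → ℤ
get []      _       = + 0
get (x ∷ _) zero    = x
get (_ ∷ w) (suc i) = get w i

-- with w = π_0 π_1 ⋯ π_n where π_0 = 0 (so get w i = π_i):
-- i is a peak iff π_{i-1} < π_i > π_{i+1}
isPeakAt : List ℤ → ℕ → Bool
isPeakAt w i = ⌊ get w (i ∸ 1) ℤ.<? get w i ⌋ ∧ ⌊ get w (suc i) ℤ.<? get w i ⌋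

peakSet : ℕ → List ℤ → List ℕ
peakSet n π = filterᵇ (isPeakAt (+ 0 ∷ π)) (interval 2 (n ∸ 1))

peakSetHat : ℕ → List ℤ → List ℕ
peakSetHat n π = filterᵇ (isPeakAt (+ 0 ∷ π)) (interval 1 (n ∸ 1))

_∈ᵇ_ : ℕ → List ℕ → Bool
i ∈ᵇ xs = any (i ≡ᵇ_) xs

sameSet : List ℕ → List ℕ → Bool
sameSet xs ys = all (_∈ᵇ ys) xs ∧ all (_∈ᵇ xs) ys

P-B : List ℕ → ℕ → List (List ℤ)
P-B S n = filterᵇ (λ π → sameSet (peakSet n π) S) (B n)

P-B-hat : List ℕ → ℕ → List (List ℤ)
P-B-hat S n = filterᵇ (λ π → sameSet (peakSetHat n π) S) (B n)

#P-B : List ℕ → ℕ → ℕ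
#P-B S n = length (P-B S n)

#P-B-hat : List ℕ → ℕ → ℕ
#P-B-hat S n = length (P-B-hat S n)

module Submission where

-- Both peak sets of π are obtained by filtering indices with the
-- same predicate "i is a peak of 0π_1⋯π_n"; the hatted set only adds the
-- candidate index 1.  Fix S with 2 ∈ S and a signed permutation π.
--  * If 1 is not a peak, the two peak sets coincide.
--  * If 1 is a peak then π_1 > π_2, so 2 is not a peak; hence 2 lies in
--    neither peak set and neither of them equals S.

open import Defs
open import Data.Nat using (ℕ; suc; _∸_; _≡ᵇ_)
open import Data.Nat.Properties using (≡ᵇ⇒≡)
open import Data.Integer using (ℤ; +_; _<?_)
open import Data.Integer.Properties using (<-asym)
open import Data.Bool using (Bool; true; false; T; _∧_)
open import Data.Bool.Properties using (∧-zeroʳ)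
open import Data.Bool.ListAction using (all)
open import Data.List using (List; []; _∷_; filterᵇ; length)
open import Data.List.Properties using (filter-≐)
open import Data.List.Membership.Propositional using (_∈_)
open import Data.List.Relation.Unary.Any using (here; there)
open import Data.Product using (_,_)
open import Data.Empty using (⊥-elim)
open import Data.Unit using (tt)
open import Function using (_∘_)
open import Relation.Nullary using (yes; no)
open import Relation.Nullary.Decidable using (⌊_⌋; T?)
open import Relation.Binary.PropositionalEquality
  using (_≡_; _≢_; refl; sym; trans; cong; subst)

filterᵇ-cong : {A : Set} {p q : A → Bool} → (∀ x → p x ≡ q x) →
               ∀ xs → filterᵇ p xs ≡ filterᵇ q xs
filterᵇ-cong {p = p} {q} p≗q =
  filter-≐ (T? ∘ p) (T? ∘ q)
    ((λ {x} → subst T (p≗q x)) , (λ {x} → subst T (sym (p≗q x))))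

∉-filterᵇ : (p : ℕ → Bool) {k : ℕ} → p k ≡ false →
            ∀ xs → k ∈ᵇ filterᵇ p xs ≡ false
∉-filterᵇ p pk [] = refl
∉-filterᵇ p pk (x ∷ xs) with p x in px
... | false = ∉-filterᵇ p pk xs
∉-filterᵇ p {k} pk (x ∷ xs) | true with k ≡ᵇ x in k≡ᵇx
... | false = ∉-filterᵇ p pk xs
... | true  = ⊥-elim (true≢false (trans (sym px) (trans (cong p k≡x) pk)))
  where
  k≡x : x ≡ k
  k≡x = sym (≡ᵇ⇒≡ k x (subst T (sym k≡ᵇx) tt))
  true≢false : true ≢ false
  true≢false ()

sameSet-missing : ∀ {k} xs S → k ∈ S → k ∈ᵇ xs ≡ false → sameSet xs S ≡ false
sameSet-missing {k} xs S k∈S k∉xs =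
  trans (cong (all (_∈ᵇ S) xs ∧_) (notAll S k∈S)) (∧-zeroʳ _)
  where
  notAll : ∀ S → k ∈ S → all (_∈ᵇ xs) S ≡ false
  notAll (_ ∷ _) (here refl) rewrite k∉xs = refl
  notAll (y ∷ S) (there k∈S) rewrite notAll S k∈S = ∧-zeroʳ (y ∈ᵇ xs)

descent⇒¬ascent : ∀ x y → ⌊ y <? x ⌋ ≡ true → ⌊ x <? y ⌋ ≡ false
descent⇒¬ascent x y desc with y <? x | x <? y
... | yes y<x | yes x<y = ⊥-elim (<-asym x<y y<x)
... | yes _   | no _    = refl
... | no _    | _       = ⊥-elim (false≢true desc)
  where
  false≢true : false ≢ true
  false≢true ()

-- Two consecutive indices are never both peaks: a peak at i is followed by
-- the descent π_i > π_{i+1}.  (Only the case where both comparisons of the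
-- peak hold is possible; Agda discards the others from the hypothesis.)
peak⇒nextNotPeak : ∀ w i → isPeakAt w i ≡ true → isPeakAt w (suc i) ≡ false
peak⇒nextNotPeak w i peak
  with ⌊ get w (i ∸ 1) <? get w i ⌋ | ⌊ get w (suc i) <? get w i ⌋ in desc
... | true | true
  rewrite descent⇒¬ascent (get w i) (get w (suc i)) desc = refl

padded : List ℤ → List ℤ
padded π = + 0 ∷ π

-- Without a peak at 1 the hatted peak set is the plain one: its index range
-- {1,…,n-1} differs from {2,…,n-1} only by the rejected index 1.
peakSetHat-noPeakAt1 : ∀ n π → isPeakAt (padded π) 1 ≡ false →
                       peakSetHat n π ≡ peakSet n π
peakSetHat-noPeakAt1 0             π _ = refl
peakSetHat-noPeakAt1 1             π _ = refl
peakSetHat-noPeakAt1 (suc (suc k)) π noPeak rewrite noPeak = refl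

2∉peakSet : ∀ n π → isPeakAt (padded π) 1 ≡ true → 2 ∈ᵇ peakSet n π ≡ false
2∉peakSet n π peak =
  ∉-filterᵇ (isPeakAt (padded π)) (peak⇒nextNotPeak (padded π) 1 peak)
    (interval 2 (n ∸ 1))

2∉peakSetHat : ∀ n π → isPeakAt (padded π) 1 ≡ true → 2 ∈ᵇ peakSetHat n π ≡ false
2∉peakSetHat n π peak =
  ∉-filterᵇ (isPeakAt (padded π)) (peak⇒nextNotPeak (padded π) 1 peak)
    (interval 1 (n ∸ 1))

samePeakTest : ∀ S n → 2 ∈ S → ∀ π →
               sameSet (peakSet n π) S ≡ sameSet (peakSetHat n π) S
samePeakTest S n 2∈S π with isPeakAt (padded π) 1 in peakAt1
... | false = cong (λ P → sameSet P S) (sym (peakSetHat-noPeakAt1 n π peakAt1))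
... | true  = trans (sameSet-missing (peakSet n π) S 2∈S (2∉peakSet n π peakAt1))
                    (sym (sameSet-missing (peakSetHat n π) S 2∈S
                                          (2∉peakSetHat n π peakAt1)))

corollary3p6 : (S : List ℕ) (n : ℕ) → 2 ∈ S → #P-B S n ≢ 0 →
    #P-B S n ≡ #P-B-hat S n
corollary3p6 S n 2∈S _ =
  cong length (filterᵇ-cong (samePeakTest S n 2∈S) (B n))
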